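{- Let $t$ be a positive integer, let $n>t+1$, let $\mathcal A\in I(n,t)$ be maximal, compressed and fixed, and let $E_1,E_2$ be sets in some $g\in G_*(\mathcal A)$. If there exist $i<j$ in $[n]$ with $i\notin E_1\cup E_2$ and $j\in E_1\cap E_2$, then $|E_1\cap E_2|\ge t+1$.
   Context: $S_n$ is the symmetric group on $[n]=\{1,\dots,n\}$; $\mathrm{fix}(\sigma)=\{x:\sigma(x)=x\}$. Two permutations have a cycle in common if that cycle appears in both cycle decompositions (1-cycles count). $\mathcal A\subseteq S_n$ is $t$-cycle-intersecting if any two distinct members have at least $t$ common cycles; $I(n,t)$ is the collection of all such families; $\mathcal A\in I(n,t)$ is maximal if no $\sigma\notin\mathcal A$ can be added keeping the property. Fixing: for $i\ne j$, ${}_{[ij]}\sigma=\sigma$ if $\sigma(i)\ne j$; if $\sigma(i)=j$, ${}_{[ij]}\sigma(i)=i$, ${}_{[ij]}\sigma(\sigma^{ -1}(i))=j$, ${}_{[ij]}\sigma(x)=\sigma(x)$ otherwise; $\triangleleft_{ij}(\mathcal A)=\{\triangleleft_{ij}(\sigma):\sigma\in\mathcal A\}$ with $\triangleleft_{ij}(\sigma)={}_{[ij]}\sigma$ if ${}_{[ij]}\sigma\notin\mathcal A$, else $\sigma$; $\mathcal A$ is fixed if $\triangleleft_{ij}(\mathcal A)=\mathcal A$ for all $i\ne j$. Compression: for $i<j$, $\sigma_{i,j}=\sigma$ if $\sigma(i)=i$ or $\sigma(j)\ne j$; otherwise $\sigma_{i,j}(i)=i$, $\sigma_{i,j}(j)=\sigma(i)$,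 $\sigma_{i,j}(\sigma^{ -1}(i))=j$, $\sigma_{i,j}(y)=\sigma(y)$ otherwise; $\mathcal C_{i,j}(\mathcal A)=\{\mathcal C_{i,j}(\sigma):\sigma\in\mathcal A\}$ with $\mathcal C_{i,j}(\sigma)=\sigma_{i,j}$ if $\sigma_{i,j}\notin\mathcal A$, else $\sigma$; $\mathcal A$ is compressed if $\mathcal C_{i,j}(\mathcal A)=\mathcal A$ for all $i<j$. $\mathscr U_p(B)=\{\sigma: B\subseteq\mathrm{fix}(\sigma)\}$, $\mathscr U_p(\mathcal B)=\bigcup_{B\in\mathcal B}\mathscr U_p(B)$; a generating set for $\mathcal A$ is a collection $g$ of subsets of $[n]$ with no set of size $n-1$ and $\mathscr U_p(g)=\mathcal A$; $G(\mathcal A)$ is the set of generating sets. For $B=\{b_1<\dots<b_k\}$, $\mathscr L(B)=\{\{a_1<\dots<a_k\}\subseteq[n]: a_i\le b_i\ \forall i\}$; $\mathscr L(g)=\bigcup_{B\in g}\mathscr L(B)$; $\mathscr L_*(g)$ is the set of inclusion-minimal elements of $\mathscr L(g)$. $G_*(\mathcal A)=\{g\in G(\mathcal A):\mathscr L_*(g)=g\}$. -}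

module Defs where

open import Data.Nat as ℕ using (ℕ; zero; suc; _∸_)
open import Data.Fin as Fin using (Fin; zero; suc; _≟_)
open import Data.Fin.Subset using (Subset; inside; outside; _⊆_) renaming (_∈_ to _∈ₛ_)
open import Data.Vec using (Vec; []; _∷_; lookup; tabulate)
open import Data.List using (List; []; _∷_; map)
open import Data.List.Membership.Propositional using () renaming (_∈_ to _∈ₗ_)
open import Data.List.Relation.Binary.Pointwise using (Pointwise)
open import Data.Bool using (Bool; true; false; if_then_else_)
open import Data.Product using (Σ; ∃; _×_; _,_)
open import Data.Sum using (_⊎_)
open import Relation.Binary.PropositionalEquality using (_≡_; _≢_)
open import Relation.Nullary using (¬_; does)
open import Function using (_⇔_)

-- Permutations of [n] = Fin n, represented by their value vectors.
-- σ(x) = lookup σ x.  S_n = vectors whose lookup is injective.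

Vecₚ : ℕ → Set
Vecₚ n = Vec (Fin n) n

app : ∀ {n} → Vecₚ n → Fin n → Fin n
app = lookup

IsPerm : ∀ {n} → Vecₚ n → Set
IsPerm {n} σ = ∀ (x y : Fin n) → app σ x ≡ app σ y → x ≡ y

iter : ∀ {n} → Vecₚ n → ℕ → Fin n → Fin n
iter σ zero x = x
iter σ (suc k) x = app σ (iter σ k x)

-- The cycle of σ through x coincides with the cycle of τ through x
-- (same orbit, same cyclic order): σ^k(x) = τ^k(x) for every k.
SharedCycleAt : ∀ {n} → Vecₚ n → Vecₚ n → Fin n → Set
SharedCycleAt σ τ x = ∀ k → iter σ k x ≡ iter τ k x

-- σ and τ have at least t cycles in common: there are t points, each
-- lying on a common cycle, no two of them on the same cycle of σ.
CommonCycles≥ : ∀ {n} → ℕ → Vecₚ n → Vecₚ n → Set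
CommonCycles≥ {n} t σ τ =
  Σ (Fin t → Fin n) λ r →
    (∀ a → SharedCycleAt σ τ (r a)) ×
    (∀ a b → a ≢ b → ¬ (∃ λ k → iter σ k (r a) ≡ r b))

Family : ℕ → Set
Family n = Vecₚ n → Bool

_∈F_ : ∀ {n} → Vecₚ n → Family n → Set
σ ∈F A = A σ ≡ true

TInt : ∀ {n} → ℕ → (Vecₚ n → Set) → Set
TInt t P = ∀ σ τ → P σ → P τ → σ ≢ τ → CommonCycles≥ t σ τ

InI : (n t : ℕ) → Family n → Set
InI n t A = (∀ σ → σ ∈F A → IsPerm σ) × TInt t (λ σ → σ ∈F A)

Maximal : (n t : ℕ) → Family n → Set
Maximal n t A = ∀ σ → IsPerm σ → A σ ≡ false →
  ¬ TInt t (λ τ → τ ∈F A ⊎ τ ≡ σ)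

shiftOne : ∀ {n} → Family n → (Vecₚ n → Vecₚ n) → Vecₚ n → Vecₚ n
shiftOne A f σ = if A (f σ) then σ else f σ

ShiftInvariant : ∀ {n} → Family n → (Vecₚ n → Vecₚ n) → Set
ShiftInvariant A f = ∀ τ → (∃ λ σ → σ ∈F A × shiftOne A f σ ≡ τ) ⇔ (τ ∈F A)

-- Fixing operation [ij]σ (pointwise form; σ⁻¹(i) is the x with σ(x)=i)
fixingFun : ∀ {n} → Fin n → Fin n → Vecₚ n → Vecₚ n
fixingFun i j σ =
  if does (app σ i ≟ j)
  then tabulate (λ x → if does (x ≟ i) then i
                       else if does (app σ x ≟ i) then j
                       else app σ x)
  else σ

Fixed : ∀ {n} → Family n → Set
Fixed {n} A = ∀ (i j : Fin n) → i ≢ j → ShiftInvariant A (fixingFun i j)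

compFun : ∀ {n} → Fin n → Fin n → Vecₚ n → Vecₚ n
compFun i j σ =
  if does (app σ i ≟ i) then σ
  else if does (app σ j ≟ j)
  then tabulate (λ x → if does (x ≟ i) then i
                       else if does (x ≟ j) then app σ i
                       else if does (app σ x ≟ i) then j
                       else app σ x)
  else σ

Compressed : ∀ {n} → Family n → Set
Compressed {n} A = ∀ (i j : Fin n) → i Fin.< j → ShiftInvariant A (compFun i j)

fixSet : ∀ {n} → Vecₚ n → Subset n
fixSet σ = tabulate (λ x → if does (app σ x ≟ x) then inside else outside)

InUp : ∀ {n} → List (Subset n) → Vecₚ n → Set
InUp g σ = IsPerm σ × ∃ λ B → B ∈ₗ g × B ⊆ fixSet σ

IsGenerating : ∀ {n} → Family n → List (Subset n) → Set
IsGenerating {n} A g =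
  (∀ B → B ∈ₗ g → Data.Fin.Subset.∣ B ∣ ≢ n ∸ 1) ×
  (∀ σ → σ ∈F A ⇔ InUp g σ)

elems : ∀ {n} → Subset n → List (Fin n)
elems [] = []
elems (true ∷ p) = zero ∷ map suc (elems p)
elems (false ∷ p) = map suc (elems p)

-- A ∈ 𝓛(B): |A| = |B| and a_i ≤ b_i for the sorted elements
InL : ∀ {n} → Subset n → Subset n → Set
InL B A = Pointwise Fin._≤_ (elems A) (elems B)

InLg : ∀ {n} → List (Subset n) → Subset n → Set
InLg g A = ∃ λ B → B ∈ₗ g × InL B A

InL* : ∀ {n} → List (Subset n) → Subset n → Set
InL* g A = InLg g A × (∀ F → InLg g F → F ⊆ A → F ≡ A)

InGStar : ∀ {n} → Family n → List (Subset n) → Set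
InGStar A g = IsGenerating A g × (∀ E → InL* g E ⇔ E ∈ₗ g)

module Submission where

open import Defs
open import Data.Nat using (ℕ; suc; _+_; _<_; _≤_)
open import Data.Fin using (Fin)
open import Data.Fin.Subset using (Subset; _∈_; _∉_; _∪_; _∩_; ∣_∣)
open import Data.List using (List)
open import Data.List.Membership.Propositional using () renaming (_∈_ to _∈ₗ_)
open import Data.Product using (_×_)

open import Data.Nat as ℕ using (z≤n; s≤s; _∸_)
open import Data.Nat.Properties using (≤-trans; ≤-antisym; ≤-reflexive)
open import Data.Fin using (zero; suc; _≟_)
open import Data.Fin.Properties using (any?; suc-injective; <⇒≢; 0≢1+n)
open import Data.Fin.Subset using (_-_; ⁅_⁆; ∁; _⊆_)
open import Data.Fin.Subset.Properties
  using ( _∈?_; x∈p∪q⁺; x∈p∪q⁻; x∈p∩q⁺; x∈p∩q⁻; x∉p⇒x∈∁p; x∈∁p⇒x∉p; x∈p⇒x∉∁p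
        ; x∈⁅x⁆; x∈⁅y⁆⇒x≡y; x≢y⇒x∉⁅y⁆; x∉⁅y⁆⇒x≢y; ∣∁p∣≡n∸∣p∣; ∣⁅x⁆∣≡1
        ; p⊆q⇒∣p∣≤∣q∣; x∈p∧x≢y⇒x∈p-y; x∈p⇒∣p-x∣<∣p∣ )
open import Data.Vec using ([]; _∷_; tabulate; here; there)
open import Data.Vec.Properties using (lookup∘tabulate; lookup⇒[]=)
open import Data.Bool using (Bool; true; false; if_then_else_)
open import Data.Product using (Σ; ∃; _,_; proj₁; proj₂)
open import Data.Sum using (_⊎_; inj₁; inj₂)
open import Data.Empty using (⊥; ⊥-elim)
open import Relation.Binary.PropositionalEquality
  using (_≡_; _≢_; refl; sym; trans; cong; subst)
open import Relation.Nullary using (yes; no; does)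
open import Relation.Nullary.Decidable using (dec-true; dec-false; ¬?; _×-dec_)
open import Function using (_∘_; Equivalence)
open Equivalence using (to; from)

-- We exhibit two
-- members of A which can agree only at points of (E₁ ∩ E₂) ∖ {j}.
--  * Because |E₁| ≠ n − 1 and i ∉ E₁, the complement of E₁ has two points,
--    so it has a derangement τ₁; τ₁ fixes E₁, hence lies in A.

injection⇒≤∣∣ : ∀ t {n} (P : Subset n) (r : Fin t → Fin n) →
  (∀ a b → r a ≡ r b → a ≡ b) → (∀ a → r a ∈ P) → t ≤ ∣ P ∣
injection⇒≤∣∣ ℕ.zero P r _ _ = z≤n
injection⇒≤∣∣ (suc t) P r injective inP =
  ≤-trans (s≤s (injection⇒≤∣∣ t (P - r zero) (r ∘ suc) injective′ inP′))
          (x∈p⇒∣p-x∣<∣p∣ (inP zero))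
  where
  injective′ : ∀ a b → r (suc a) ≡ r (suc b) → a ≡ b
  injective′ a b e = suc-injective (injective _ _ e)
  inP′ : ∀ a → r (suc a) ∈ P - r zero
  inP′ a = x∈p∧x≢y⇒x∈p-y (inP (suc a)) (λ e → 0≢1+n (sym (injective _ _ e)))

-- A set of size ≠ n − 1 missing i misses some second point: otherwise it
-- would be the complement of {i}.
second-point-outside : ∀ {n} (E : Subset n) (i : Fin n) → i ∉ E →
  ∣ E ∣ ≢ n ∸ 1 → ∃ λ k → k ∉ E × k ≢ i
second-point-outside {n} E i i∉E size
  with any? (λ k → ¬? (k ∈? E) ×-dec ¬? (k ≟ i))
... | yes found = found
... | no none = ⊥-elim (size (≤-antisym
        (≤-trans (p⊆q⇒∣p∣≤∣q∣ E⊆∁i) (≤-reflexive ∣∁i∣))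
        (≤-trans (≤-reflexive (sym ∣∁i∣)) (p⊆q⇒∣p∣≤∣q∣ ∁i⊆E))))
  where
  ∣∁i∣ : ∣ ∁ ⁅ i ⁆ ∣ ≡ n ∸ 1
  ∣∁i∣ = trans (∣∁p∣≡n∸∣p∣ ⁅ i ⁆) (cong (n ∸_) (∣⁅x⁆∣≡1 i))
  E⊆∁i : E ⊆ ∁ ⁅ i ⁆
  E⊆∁i x∈E = x∉p⇒x∈∁p (x≢y⇒x∉⁅y⁆ (λ x≡i → i∉E (subst (_∈ E) x≡i x∈E)))
  ∁i⊆E : ∁ ⁅ i ⁆ ⊆ E
  ∁i⊆E {x} x∈∁i with x ∈? E
  ... | yes x∈E = x∈E
  ... | no x∉E = ⊥-elim (none (x , x∉E , x∉⁅y⁆⇒x≢y (x∈∁p⇒x∉p x∈∁i)))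

Injective : ∀ {n} → (Fin n → Fin n) → Set
Injective f = ∀ x y → f x ≡ f y → x ≡ y

record Derangement {n} (M : Subset n) : Set where
  field
    fun : Fin n → Fin n
    injective : Injective fun
    moves : ∀ x → x ∈ M → fun x ≢ x
    fixes : ∀ x → x ∉ M → fun x ≡ x
open Derangement

-- A derangement maps M into M: if fun x ∉ M then fun (fun x) = fun x.
derangement-closed : ∀ {n} {M : Subset n} (D : Derangement M) →
  ∀ x → x ∈ M → fun D x ∈ M
derangement-closed {M = M} D x x∈M with fun D x ∈? M
... | yes y∈M = y∈M
... | no y∉M = ⊥-elim (moves D x x∈M (injective D _ _ (fixes D _ y∉M)))

derangement-swaps : ∀ {n} {M : Subset n} (D : Derangement M) (a b : Fin n) →
  (∀ y → y ∈ M → y ≡ a ⊎ y ≡ b) → b ∈ M → fun D b ≡ a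
derangement-swaps D a b within b∈M with within _ (derangement-closed D b b∈M)
... | inj₁ Db≡a = Db≡a
... | inj₂ Db≡b = ⊥-elim (moves D b b∈M Db≡b)

data Classification {n} (M : Subset n) : Set where
  empty : (∀ x → x ∉ M) → Classification M
  singleton : ∀ m → m ∈ M → (∀ x → x ∈ M → x ≡ m) → Classification M
  deranged : ∀ m → m ∈ M → Derangement M → Classification M

derangement-false∷ : ∀ {n} {M : Subset n} → Derangement M → Derangement (false ∷ M)
derangement-false∷ {n} {M} D = record
  { fun = lifted ; injective = lifted-injective ; moves = lifted-moves ; fixes = lifted-fixes }
  where
  lifted : Fin (suc n) → Fin (suc n)
  lifted zero = zero
  lifted (suc x) = suc (fun D x)
  lifted-injective : Injective lifted
  lifted-injective zero zero _ = refl
  lifted-injective (suc x) (suc y) e = cong suc (injective D x y (suc-injective e))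
  lifted-moves : ∀ x → x ∈ false ∷ M → lifted x ≢ x
  lifted-moves (suc x) (there x∈M) e = moves D x x∈M (suc-injective e)
  lifted-fixes : ∀ x → x ∉ false ∷ M → lifted x ≡ x
  lifted-fixes zero _ = refl
  lifted-fixes (suc x) x∉ = cong suc (fixes D x (x∉ ∘ there))

-- Insert the new point 0 into the cycle of f right after m:
-- m ↦ 0 ↦ f m, other points as by f.
insertAfter : ∀ {n} → Fin n → (Fin n → Fin n) → Fin (suc n) → Fin (suc n)
insertAfter m f zero = suc (f m)
insertAfter m f (suc x) with x ≟ m
... | yes _ = zero
... | no _ = suc (f x)

derangement-true∷ : ∀ {n} {M : Subset n} (m : Fin n) (f : Fin n → Fin n) →
  m ∈ M → Injective f → (∀ x → x ∈ M → x ≢ m → f x ≢ x) →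
  (∀ x → x ∉ M → f x ≡ x) → Derangement (true ∷ M)
derangement-true∷ {n} {M} m f m∈M f-injective f-moves f-fixes = record
  { fun = insertAfter m f ; injective = inserted-injective
  ; moves = inserted-moves ; fixes = inserted-fixes }
  where
  inserted-injective : Injective (insertAfter m f)
  inserted-injective zero zero _ = refl
  inserted-injective zero (suc y) e with y ≟ m
  inserted-injective zero (suc y) () | yes _
  ... | no y≢m = ⊥-elim (y≢m (sym (f-injective _ _ (suc-injective e))))
  inserted-injective (suc x) zero e with x ≟ m
  inserted-injective (suc x) zero () | yes _
  ... | no x≢m = ⊥-elim (x≢m (f-injective _ _ (suc-injective e)))
  inserted-injective (suc x) (suc y) e with x ≟ m | y ≟ m
  ... | yes x≡m | yes y≡m = cong suc (trans x≡m (sym y≡m))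
  inserted-injective (suc x) (suc y) () | yes _ | no _
  inserted-injective (suc x) (suc y) () | no _ | yes _
  ... | no _ | no _ = cong suc (f-injective _ _ (suc-injective e))
  inserted-moves : ∀ x → x ∈ true ∷ M → insertAfter m f x ≢ x
  inserted-moves zero _ ()
  inserted-moves (suc x) (there x∈M) e with x ≟ m
  inserted-moves (suc x) (there x∈M) () | yes _
  ... | no x≢m = f-moves x x∈M x≢m (suc-injective e)
  inserted-fixes : ∀ x → x ∉ true ∷ M → insertAfter m f x ≡ x
  inserted-fixes zero 0∉ = ⊥-elim (0∉ here)
  inserted-fixes (suc x) x∉ with x ≟ m
  ... | yes x≡m = ⊥-elim (x∉ (there (subst (_∈ M) (sym x≡m) m∈M)))
  ... | no _ = cong suc (f-fixes x (x∉ ∘ there))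

classify : ∀ {n} (M : Subset n) → Classification M
classify [] = empty (λ ())
classify (false ∷ M) with classify M
... | empty none = empty λ { zero () ; (suc x) (there x∈M) → none x x∈M }
... | singleton m m∈M only =
  singleton (suc m) (there m∈M) λ { zero () ; (suc x) (there x∈M) → cong suc (only x x∈M) }
... | deranged m m∈M D = deranged (suc m) (there m∈M) (derangement-false∷ D)
classify (true ∷ M) with classify M
... | empty none =
  singleton zero here λ { zero _ → refl ; (suc x) (there x∈M) → ⊥-elim (none x x∈M) }
... | singleton m m∈M only =
  deranged zero here (derangement-true∷ m (λ x → x) m∈M (λ _ _ e → e)
    (λ x x∈M x≢m → ⊥-elim (x≢m (only x x∈M)))
    (λ x x∉M → refl))
... | deranged m m∈M D =
  deranged zero here (derangement-true∷ m (fun D) m∈M (injective D)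
    (λ x x∈M _ → moves D x x∈M) (fixes D))

derangement : ∀ {n} (M : Subset n) (a b : Fin n) → a ∈ M → b ∈ M → a ≢ b →
  Derangement M
derangement M a b a∈M b∈M a≢b with classify M
... | empty none = ⊥-elim (none a a∈M)
... | singleton m _ only = ⊥-elim (a≢b (trans (only a a∈M) (sym (only b b∈M))))
... | deranged _ _ D = D

asPerm : ∀ {n} {M : Subset n} → Derangement M → Vecₚ n
asPerm D = tabulate (fun D)

asPerm-app : ∀ {n} {M : Subset n} (D : Derangement M) x → app (asPerm D) x ≡ fun D x
asPerm-app D = lookup∘tabulate (fun D)

asPerm-isPerm : ∀ {n} {M : Subset n} (D : Derangement M) → IsPerm (asPerm D)
asPerm-isPerm D x y e =
  injective D x y (trans (sym (asPerm-app D x)) (trans e (asPerm-app D y)))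

if-true : ∀ {X : Set} {b : Bool} {u v : X} → b ≡ true → (if b then u else v) ≡ u
if-true refl = refl

if-false : ∀ {X : Set} {b : Bool} {u v : X} → b ≡ false → (if b then u else v) ≡ v
if-false refl = refl

generated-member : ∀ {n} {A : Family n} {g : List (Subset n)} →
  IsGenerating A g → ∀ {B} → B ∈ₗ g → (σ : Vecₚ n) → IsPerm σ →
  (∀ x → x ∈ B → app σ x ≡ x) → σ ∈F A
generated-member (_ , generates) {B} B∈g σ σ-perm σ-fixes =
  from (generates σ) (σ-perm , B , B∈g , λ {x} x∈B → fixed x (σ-fixes x x∈B))
  where
  fixed : ∀ x → app σ x ≡ x → x ∈ fixSet σ
  fixed x σx≡x = lookup⇒[]= x (fixSet σ)
    (trans (lookup∘tabulate _ x) (if-true (dec-true (app σ x ≟ x) σx≡x)))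

-- If Δ_f(A) = A then A is closed under f: the image of τ under Δ_f is
-- either f τ (when f τ ∉ A) or τ itself (when f τ ∈ A already).
shift-closed : ∀ {n} (A : Family n) (f : Vecₚ n → Vecₚ n) → ShiftInvariant A f →
  ∀ τ → τ ∈F A → f τ ∈F A
shift-closed A f invariant τ τ∈A =
  closed (A (f τ)) refl (to (invariant (shiftOne A f τ)) (τ , τ∈A , refl))
  where
  closed : ∀ b → b ≡ A (f τ) → A (if b then τ else f τ) ≡ true → A (f τ) ≡ true
  closed true fτ∈A _ = sym fτ∈A
  closed false _ fτ∈A = fτ∈A

module Compression {n} (i j : Fin n) (τ : Vecₚ n)
  (τi≢i : app τ i ≢ i) (τj≡j : app τ j ≡ j) where

  private
    compressed-app : ∀ x → app (compFun i j τ) x ≡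
      (if does (x ≟ i) then i else if does (x ≟ j) then app τ i
       else if does (app τ x ≟ i) then j else app τ x)
    compressed-app x =
      trans (cong (λ σ → app σ x) (if-false (dec-false (app τ i ≟ i) τi≢i)))
     (trans (cong (λ σ → app σ x) (if-true (dec-true (app τ j ≟ j) τj≡j)))
            (lookup∘tabulate _ x))

    elsewhere : ∀ x → x ≢ i → x ≢ j → app (compFun i j τ) x ≡
      (if does (app τ x ≟ i) then j else app τ x)
    elsewhere x x≢i x≢j = trans (compressed-app x)
      (trans (if-false (dec-false (x ≟ i) x≢i)) (if-false (dec-false (x ≟ j) x≢j)))

  at-i : app (compFun i j τ) i ≡ i
  at-i = trans (compressed-app i) (if-true (dec-true (i ≟ i) refl))

  at-j : i ≢ j → app (compFun i j τ) j ≡ app τ i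
  at-j i≢j = trans (compressed-app j)
    (trans (if-false (dec-false (j ≟ i) (i≢j ∘ sym))) (if-true (dec-true (j ≟ j) refl)))

  into-i : ∀ x → x ≢ i → x ≢ j → app τ x ≡ i → app (compFun i j τ) x ≡ j
  into-i x x≢i x≢j τx≡i =
    trans (elsewhere x x≢i x≢j) (if-true (dec-true (app τ x ≟ i) τx≡i))

  unchanged : ∀ x → x ≢ i → x ≢ j → app τ x ≢ i → app (compFun i j τ) x ≡ app τ x
  unchanged x x≢i x≢j τx≢i =
    trans (elsewhere x x≢i x≢j) (if-false (dec-false (app τ x ≟ i) τx≢i))

record FirstShape {n} (E : Subset n) (i j : Fin n) (σ : Fin n → Fin n) : Set where
  field
    fixes-i : σ i ≡ i
    moves-j : σ j ≢ j
    fixes-E : ∀ x → x ∈ E → x ≢ j → σ x ≡ x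
    outside-E : ∀ x → x ∉ E → x ≢ i → σ x ≢ x × σ x ≢ i

compressed-shape : ∀ {n} (E : Subset n) (i j : Fin n) → i ≢ j → i ∉ E → j ∈ E →
  (τ : Vecₚ n) → IsPerm τ → (∀ x → x ∈ E → app τ x ≡ x) →
  (∀ x → x ∉ E → app τ x ≢ x) → FirstShape E i j (app (compFun i j τ))
compressed-shape E i j i≢j i∉E j∈E τ τ-perm τ-fixes τ-moves = record
  { fixes-i = at-i
  ; moves-j = λ σj≡j → i≢j (τ-perm i j (trans (sym (at-j i≢j)) (trans σj≡j (sym τj≡j))))
  ; fixes-E = fixes-E
  ; outside-E = outside-E
  }
  where
  τj≡j = τ-fixes j j∈E
  open Compression i j τ (τ-moves i i∉E) τj≡j
  ≢i : ∀ {x} → x ∈ E → x ≢ i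
  ≢i x∈E x≡i = i∉E (subst (_∈ E) x≡i x∈E)
  fixes-E : ∀ x → x ∈ E → x ≢ j → app (compFun i j τ) x ≡ x
  fixes-E x x∈E x≢j = trans (unchanged x (≢i x∈E) x≢j τx≢i) (τ-fixes x x∈E)
    where
    τx≢i : app τ x ≢ i
    τx≢i τx≡i = ≢i x∈E (trans (sym (τ-fixes x x∈E)) τx≡i)
  outside-E : ∀ x → x ∉ E → x ≢ i →
    app (compFun i j τ) x ≢ x × app (compFun i j τ) x ≢ i
  outside-E x x∉E x≢i with app τ x ≟ i
  ... | yes τx≡i = (λ e → x≢j (trans (sym e) σx≡j)) , (λ e → i≢j (trans (sym e) σx≡j))
    where
    x≢j : x ≢ j
    x≢j x≡j = x∉E (subst (_∈ E) (sym x≡j) j∈E)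
    σx≡j = into-i x x≢i x≢j τx≡i
  ... | no τx≢i = (λ e → τ-moves x x∉E (trans (sym σx≡τx) e))
                , (λ e → τx≢i (trans (sym σx≡τx) e))
    where
    σx≡τx = unchanged x x≢i (λ x≡j → x∉E (subst (_∈ E) (sym x≡j) j∈E)) τx≢i

record SecondShape {n} (E₁ E₂ : Subset n) (i : Fin n) (τ : Fin n → Fin n) : Set where
  field
    fixes-E₂ : ∀ x → x ∈ E₂ → τ x ≡ x
    moves-i : τ i ≢ i
    outside-E₁ : ∀ x → x ∉ E₁ → x ≢ i → τ x ≡ x ⊎ τ x ≡ i
    moves-E₁∖E₂ : ∀ x → x ∈ E₁ → x ∉ E₂ → τ x ≢ x

derangement-second-shape : ∀ {n} (E₁ E₂ M : Subset n) (i : Fin n) (D : Derangement M) →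
  (∀ x → x ∈ E₂ → x ∉ M) → i ∈ M → (∀ x → x ∈ E₁ → x ∉ E₂ → x ∈ M) →
  (∀ x → x ∈ M → x ∉ E₁ → x ≢ i → fun D x ≡ i) → SecondShape E₁ E₂ i (app (asPerm D))
derangement-second-shape E₁ E₂ M i D E₂∩M≡∅ i∈M E₁∖E₂⊆M to-i = record
  { fixes-E₂ = λ x x∈E₂ → trans (asPerm-app D x) (fixes D x (E₂∩M≡∅ x x∈E₂))
  ; moves-i = moves D i i∈M ∘ trans (sym (asPerm-app D i))
  ; outside-E₁ = outside-E₁
  ; moves-E₁∖E₂ = λ x x∈E₁ x∉E₂ →
      moves D x (E₁∖E₂⊆M x x∈E₁ x∉E₂) ∘ trans (sym (asPerm-app D x))
  }
  where
  outside-E₁ : ∀ x → x ∉ E₁ → x ≢ i → app (asPerm D) x ≡ x ⊎ app (asPerm D) x ≡ i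
  outside-E₁ x x∉E₁ x≢i with x ∈? M
  ... | yes x∈M = inj₂ (trans (asPerm-app D x) (to-i x x∈M x∉E₁ x≢i))
  ... | no x∉M = inj₁ (trans (asPerm-app D x) (fixes D x x∉M))

second-witness-derange : ∀ {n} (E₁ E₂ : Subset n) (i y : Fin n) → i ∉ E₁ → i ∉ E₂ →
  y ∈ E₁ → y ∉ E₂ → Σ (Vecₚ n) λ τ → IsPerm τ × SecondShape E₁ E₂ i (app τ)
second-witness-derange {n} E₁ E₂ i y i∉E₁ i∉E₂ y∈E₁ y∉E₂ =
  asPerm D , asPerm-isPerm D ,
  derangement-second-shape E₁ E₂ M i D E₂∩M≡∅ i∈M E₁∖E₂⊆M to-i
  where
  M : Subset n
  M = (E₁ ∩ ∁ E₂) ∪ ⁅ i ⁆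
  i∈M : i ∈ M
  i∈M = x∈p∪q⁺ (inj₂ (x∈⁅x⁆ i))
  E₁∖E₂⊆M : ∀ x → x ∈ E₁ → x ∉ E₂ → x ∈ M
  E₁∖E₂⊆M x x∈E₁ x∉E₂ = x∈p∪q⁺ (inj₁ (x∈p∩q⁺ (x∈E₁ , x∉p⇒x∈∁p x∉E₂)))
  D : Derangement M
  D = derangement M y i (E₁∖E₂⊆M y y∈E₁ y∉E₂) i∈M
        (λ y≡i → i∉E₁ (subst (_∈ E₁) y≡i y∈E₁))
  E₂∩M≡∅ : ∀ x → x ∈ E₂ → x ∉ M
  E₂∩M≡∅ x x∈E₂ x∈M with x∈p∪q⁻ _ _ x∈M
  ... | inj₁ x∈E₁∖E₂ = x∈∁p⇒x∉p (proj₂ (x∈p∩q⁻ _ _ x∈E₁∖E₂)) x∈E₂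
  ... | inj₂ x∈⁅i⁆ = i∉E₂ (subst (_∈ E₂) (x∈⁅y⁆⇒x≡y i x∈⁅i⁆) x∈E₂)
  -- vacuous: the only point of M outside E₁ is i
  to-i : ∀ x → x ∈ M → x ∉ E₁ → x ≢ i → fun D x ≡ i
  to-i x x∈M x∉E₁ x≢i with x∈p∪q⁻ _ _ x∈M
  ... | inj₁ x∈E₁∖E₂ = ⊥-elim (x∉E₁ (proj₁ (x∈p∩q⁻ _ _ x∈E₁∖E₂)))
  ... | inj₂ x∈⁅i⁆ = ⊥-elim (x≢i (x∈⁅y⁆⇒x≡y i x∈⁅i⁆))

second-witness-swap : ∀ {n} (E₁ E₂ : Subset n) (i k : Fin n) → i ∉ E₂ →
  k ∉ E₂ → k ≢ i → (∀ x → x ∈ E₁ → x ∈ E₂) →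
  Σ (Vecₚ n) λ τ → IsPerm τ × SecondShape E₁ E₂ i (app τ)
second-witness-swap {n} E₁ E₂ i k i∉E₂ k∉E₂ k≢i E₁⊆E₂ =
  asPerm D , asPerm-isPerm D ,
  derangement-second-shape E₁ E₂ M i D E₂∩M≡∅ i∈M
    (λ x x∈E₁ x∉E₂ → ⊥-elim (x∉E₂ (E₁⊆E₂ x x∈E₁))) to-i
  where
  M : Subset n
  M = ⁅ i ⁆ ∪ ⁅ k ⁆
  i∈M : i ∈ M
  i∈M = x∈p∪q⁺ (inj₁ (x∈⁅x⁆ i))
  k∈M : k ∈ M
  k∈M = x∈p∪q⁺ (inj₂ (x∈⁅x⁆ k))
  D : Derangement M
  D = derangement M k i k∈M i∈M k≢i
  i-or-k : ∀ x → x ∈ M → x ≡ i ⊎ x ≡ k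
  i-or-k x x∈M with x∈p∪q⁻ _ _ x∈M
  ... | inj₁ x∈⁅i⁆ = inj₁ (x∈⁅y⁆⇒x≡y i x∈⁅i⁆)
  ... | inj₂ x∈⁅k⁆ = inj₂ (x∈⁅y⁆⇒x≡y k x∈⁅k⁆)
  E₂∩M≡∅ : ∀ x → x ∈ E₂ → x ∉ M
  E₂∩M≡∅ x x∈E₂ x∈M with i-or-k x x∈M
  ... | inj₁ x≡i = i∉E₂ (subst (_∈ E₂) x≡i x∈E₂)
  ... | inj₂ x≡k = k∉E₂ (subst (_∈ E₂) x≡k x∈E₂)
  to-i : ∀ x → x ∈ M → x ∉ E₁ → x ≢ i → fun D x ≡ i
  to-i x x∈M _ x≢i with i-or-k x x∈M
  ... | inj₁ x≡i = ⊥-elim (x≢i x≡i)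
  ... | inj₂ refl = derangement-swaps D i k i-or-k k∈M

second-witness : ∀ {n} (E₁ E₂ : Subset n) (i k : Fin n) → i ∉ E₁ → i ∉ E₂ →
  k ∉ E₂ → k ≢ i → Σ (Vecₚ n) λ τ → IsPerm τ × SecondShape E₁ E₂ i (app τ)
second-witness E₁ E₂ i k i∉E₁ i∉E₂ k∉E₂ k≢i
  with any? (λ y → (y ∈? E₁) ×-dec ¬? (y ∈? E₂))
... | yes (y , y∈E₁ , y∉E₂) = second-witness-derange E₁ E₂ i y i∉E₁ i∉E₂ y∈E₁ y∉E₂
... | no E₁⊄E₂ = second-witness-swap E₁ E₂ i k i∉E₂ k∉E₂ k≢i E₁⊆E₂
  where
  E₁⊆E₂ : ∀ x → x ∈ E₁ → x ∈ E₂
  E₁⊆E₂ x x∈E₁ with x ∈? E₂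
  ... | yes x∈E₂ = x∈E₂
  ... | no x∉E₂ = ⊥-elim (E₁⊄E₂ (x , x∈E₁ , x∉E₂))

-- A permutation fixing exactly E exists when E misses i and |E| ≠ n − 1:
-- derange the complement of E, which has at least two points.
exact-fixer : ∀ {n} (E : Subset n) (i : Fin n) → i ∉ E → ∣ E ∣ ≢ n ∸ 1 →
  Σ (Vecₚ n) λ τ → IsPerm τ ×
    (∀ x → x ∈ E → app τ x ≡ x) × (∀ x → x ∉ E → app τ x ≢ x)
exact-fixer E i i∉E size =
  asPerm D , asPerm-isPerm D
  , (λ x x∈E → trans (asPerm-app D x) (fixes D x (x∈p⇒x∉∁p x∈E)))
  , (λ x x∉E → moves D x (x∉p⇒x∈∁p x∉E) ∘ trans (sym (asPerm-app D x)))
  where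
  other = second-point-outside E i i∉E size
  D : Derangement (∁ E)
  D = derangement (∁ E) i (proj₁ other) (x∉p⇒x∈∁p i∉E)
        (x∉p⇒x∈∁p (proj₁ (proj₂ other))) (proj₂ (proj₂ other) ∘ sym)

agreement : ∀ {n} {E₁ E₂ : Subset n} {i j : Fin n} {σ τ : Fin n → Fin n} →
  FirstShape E₁ i j σ → SecondShape E₁ E₂ i τ → j ∈ E₂ →
  ∀ x → σ x ≡ τ x → x ∈ (E₁ ∩ E₂) - j
agreement {E₁ = E₁} {E₂} {i} {j} {σ} {τ} σ-shape τ-shape j∈E₂ x σx≡τx
  with x ≟ i | x ≟ j | x ∈? E₁ | x ∈? E₂
... | yes refl | _ | _ | _ = ⊥-elim (moves-i (trans (sym σx≡τx) fixes-i))
  where open FirstShape σ-shape; open SecondShape τ-shape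
... | no _ | yes refl | _ | _ = ⊥-elim (moves-j (trans σx≡τx (fixes-E₂ j j∈E₂)))
  where open FirstShape σ-shape; open SecondShape τ-shape
... | no x≢i | no _ | no x∉E₁ | _ = ⊥-elim (impossible (outside-E₁ x x∉E₁ x≢i))
  where
  open SecondShape τ-shape
  σ-avoids = FirstShape.outside-E σ-shape x x∉E₁ x≢i
  impossible : τ x ≡ x ⊎ τ x ≡ i → ⊥
  impossible (inj₁ τx≡x) = proj₁ σ-avoids (trans σx≡τx τx≡x)
  impossible (inj₂ τx≡i) = proj₂ σ-avoids (trans σx≡τx τx≡i)
... | no _ | no x≢j | yes x∈E₁ | no x∉E₂ =
  ⊥-elim (moves-E₁∖E₂ x x∈E₁ x∉E₂ (trans (sym σx≡τx) (fixes-E x x∈E₁ x≢j)))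
  where open FirstShape σ-shape; open SecondShape τ-shape
... | no _ | no x≢j | yes x∈E₁ | yes x∈E₂ = x∈p∧x≢y⇒x∈p-y (x∈p∩q⁺ (x∈E₁ , x∈E₂)) x≢j

agreeing-members : ∀ {n} (A : Family n) (g : List (Subset n)) → Compressed A →
  IsGenerating A g → ∀ {E₁ E₂} → E₁ ∈ₗ g → E₂ ∈ₗ g → (i j : Fin n) →
  i Data.Fin.< j → i ∉ E₁ → i ∉ E₂ → j ∈ E₁ → j ∈ E₂ →
  Σ (Vecₚ n) λ σ → Σ (Vecₚ n) λ τ → σ ∈F A × τ ∈F A × σ ≢ τ ×
    (∀ x → app σ x ≡ app τ x → x ∈ (E₁ ∩ E₂) - j)
agreeing-members A g compressed generating {E₁} {E₂} E₁∈g E₂∈g i j i<j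
                 i∉E₁ i∉E₂ j∈E₁ j∈E₂ =
  let small = proj₁ generating
      (τ₁ , τ₁-perm , τ₁-fixes , τ₁-moves) = exact-fixer E₁ i i∉E₁ (small E₁ E₁∈g)
      σ = compFun i j τ₁
      σ∈A = shift-closed A (compFun i j) (compressed i j i<j) τ₁
              (generated-member generating E₁∈g τ₁ τ₁-perm τ₁-fixes)
      σ-shape = compressed-shape E₁ i j (<⇒≢ i<j) i∉E₁ j∈E₁ τ₁ τ₁-perm τ₁-fixes τ₁-moves
      (k , k∉E₂ , k≢i) = second-point-outside E₂ i i∉E₂ (small E₂ E₂∈g)
      (τ₂ , τ₂-perm , τ₂-shape) = second-witness E₁ E₂ i k i∉E₁ i∉E₂ k∉E₂ k≢i
      τ₂∈A = generated-member generating E₂∈g τ₂ τ₂-perm (SecondShape.fixes-E₂ τ₂-shape)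
      σ≢τ₂ : σ ≢ τ₂
      σ≢τ₂ σ≡τ₂ = FirstShape.moves-j σ-shape
        (trans (cong (λ π → app π j) σ≡τ₂) (SecondShape.fixes-E₂ τ₂-shape j j∈E₂))
  in σ , τ₂ , σ∈A , τ₂∈A , σ≢τ₂ , agreement σ-shape τ₂-shape j∈E₂

common-points : ∀ {n t} {σ τ : Vecₚ n} → CommonCycles≥ t σ τ →
  Σ (Fin t → Fin n) λ r → (∀ a b → r a ≡ r b → a ≡ b) ×
    (∀ a → app σ (r a) ≡ app τ (r a))
common-points (r , shared , separate) = r , distinct , (λ a → shared a 1)
  where
  distinct : ∀ a b → r a ≡ r b → a ≡ b
  distinct a b ra≡rb with a ≟ b
  ... | yes a≡b = a≡b
  ... | no a≢b = ⊥-elim (separate a b a≢b (0 , ra≡rb))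

lemma2p13 : (t n : ℕ) → 1 ≤ t → suc t < n →
    (A : Family n) → InI n t A → Maximal n t A → Compressed A → Fixed A →
    (g : List (Subset n)) → InGStar A g →
    (E₁ E₂ : Subset n) → E₁ ∈ₗ g → E₂ ∈ₗ g →
    (i j : Fin n) → i Data.Fin.< j → i ∉ E₁ ∪ E₂ → j ∈ E₁ ∩ E₂ →
    suc t ≤ ∣ E₁ ∩ E₂ ∣
lemma2p13 t n _ _ A (_ , intersecting) _ compressed _ g (generating , _)
          E₁ E₂ E₁∈g E₂∈g i j i<j i∉E₁∪E₂ j∈E₁∩E₂ =
  let (σ , τ , σ∈A , τ∈A , σ≢τ , agree⇒in) =
        agreeing-members A g compressed generating E₁∈g E₂∈g i j i<j
          (i∉E₁∪E₂ ∘ x∈p∪q⁺ ∘ inj₁) (i∉E₁∪E₂ ∘ x∈p∪q⁺ ∘ inj₂)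
          (proj₁ (x∈p∩q⁻ _ _ j∈E₁∩E₂)) (proj₂ (x∈p∩q⁻ _ _ j∈E₁∩E₂))
      (r , r-injective , r-agrees) = common-points (intersecting σ τ σ∈A τ∈A σ≢τ)
      -- t points of (E₁ ∩ E₂) ∖ {j}, plus j itself
      t≤∣E₁∩E₂-j∣ = injection⇒≤∣∣ t ((E₁ ∩ E₂) - j) r r-injective
                      (λ a → agree⇒in (r a) (r-agrees a))
  in ≤-trans (s≤s t≤∣E₁∩E₂-j∣) (x∈p⇒∣p-x∣<∣p∣ j∈E₁∩E₂)
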